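{- Let $\mathcal{G}=(\Gamma_{T_0},\mathcal{N},\mathcal{P})$ be a substitution-set grammar, let $\Gamma_T\in\mathcal{N}$, let $x_1,x_2\in\mathcal{V}ar(T)$, assume that the regular tree grammar $\mathcal{G}'=\mathcal{R}an(\mathcal{G},T,x_1,x_2)$ is constructed (i.e. the production rules reachable from $\Gamma_T$ satisfy the shape assumption described in the context). Let $t_1,t_2\in\mathcal{T}(\mathcal{C},\mathcal{V})$, let $\xi\in\mathit{Subst}(\mathcal{C})$ with $\mathcal{D}om(\xi)\supseteq\mathcal{V}ar(t_1,t_2)$, and let $\xi_A=\{x\mapsto A\mid x\in\mathcal{V}ar(t_1,t_2)\}$. Then all of the following hold: (1) there exists $u\in\langle \xi_A(t_1),\xi_A(t_2)\rangle_{\top}$ such that $u\to^*_{\mathcal{G}'}\langle \xi(t_1),\xi(t_2)\rangle$; (2) there exists $u\in\langle \xi_A(t_1),\bot\rangle_{\top}$ such that $u\to^*_{\mathcal{G}'}\langle \xi(t_1),\bot\rangle$; (3) there exists $u\in\langle \bot,\xi_A(t_2)\rangle_{\top}$ such that $u\to^*_{\mathcal{G}'}\langle \bot,\xi(t_2)\rangle$.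
   Context: Fix a countably infinite set $\mathcal{V}$ of variables and a finite set $\mathcal{C}$ of constructor symbols with arities; $\mathcal{T}(\mathcal{C},\mathcal{V})$ denotes terms, $\mathcal{T}(\mathcal{C})$ ground terms, $\mathit{Subst}(\mathcal{C})$ the substitutions whose range consists of ground terms in $\mathcal{T}(\mathcal{C})$. $\mathcal{D}om$, $\mathcal{V}ar$ have their usual meaning; $\mathcal{VR}an(\sigma)=\bigcup_{x\in\mathcal{D}om(\sigma)}\mathcal{V}ar(\sigma(x))$. Composition: $(\theta\sigma)(x)=\theta(\sigma(x))$. A goal clause is a term (a conjunction of pairs of terms); $\top$ denotes the trivial goal clause without variables. $A$ is a fresh constant. Coding of pairs: over the signature $(\mathcal{C}\cup\{\bot\})^2$ ($\bot$ a new constant), the symbol $\langle f,g\rangle$ has arity $\max(\mathrm{arity}(f),\mathrm{arity}(g))$. For ground terms: $\langle f(s_1..s_m),g(t_1..t_n)\rangle=\langle f,g\rangle(\langle s_1,t_1\rangle,\dots,\langle s_m,t_m\rangle,\langle\bot,t_{m+1}\rangle,\dots,\langle\bot,t_n\rangle)$ if $m\le n$, and $=\langle f,g\rangle(\langle s_1,t_1\rangle,\dots,\langle s_n,t_n\rangle,\langle s_{n+1},\bot\rangle,\dots,\langle s_m,\bot\rangle)$ if $m>n$; $\langle f(s_1..s_m),\bot\rangle=\langle f,\bot\rangle(\langle s_1,\bot\rangle,\dots,\langle s_m,\bot\rangle)$; $\langle\bot,g(t_1..t_n)\rangle=\langle\bot,g\rangle(\langle\bot,t_1\rangle,\dots,\langle\bot,t_n\rangle)$.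 Substitution expressions: $\Sigma$ consists of finitely many idempotent substitutions (as constants), a constant $\varnothing$, associative binary symbols $\bullet$ and $\&$, and a binary symbol $\textsc{rec}$ whose second argument is always an idempotent renaming $\delta$. Parallel composition of idempotent substitutions: $\theta_1\Uparrow\theta_2$ is an idempotent most general unifier $\sigma$ of $\{x\approx\theta_1(x)\}\cup\{x\approx\theta_2(x)\}$ with $\mathcal{D}om(\theta_1)\cup\mathcal{D}om(\theta_2)\subseteq\mathcal{D}om(\sigma)$ if unifiable, and $\mathit{fail}$ otherwise. For substitutions $\sigma,\delta$, $\sigma^{\delta}=(\xi\sigma)|_{\mathcal{D}om(\sigma)}$ for a renaming $\xi$ with $\mathcal{D}om(\xi)=\mathcal{VR}an(\sigma)$ and $\mathcal{VR}an(\xi)$ disjoint from $\mathcal{D}om(\delta)\cup\mathcal{VR}an(\delta)\cup\mathcal{D}om(\sigma)$ and from all variables in substitutions of $\Sigma$. Semantics $[\![\cdot]\!]$ of ground terms over $\Sigma$: $[\![\theta]\!]=\theta$; $[\![e_1\bullet e_2]\!]=[\![e_1]\!]\cdot[\![e_2]\!]$; $[\![e_1\& e_2]\!]=(\theta_1\Uparrow\theta_2)|_{\mathcal{D}om(\theta_1)\cup\mathcal{D}om(\theta_2)}$ with $\theta_1=[\![e_1]\!]$, $\theta_2=[\![e_2]\!]^{\theta_1}$; $[\![\textsc{rec}(e,\delta)]\!]=([\![e]\!]^{\delta}\cdot\delta)|_{\mathcal{D}om(\delta)}$ provided $\mathcal{VR}an(\delta)\subseteq\mathcal{D}om([\![e]\!])$;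 in all other cases (including any subexpression yielding $\mathit{fail}$, and $\varnothing$) the result is $\mathit{fail}$. A substitution-set grammar (SSG) $\mathcal{G}=(\Gamma_{T_0},\mathcal{N},\mathcal{P})$ is a regular tree grammar whose non-terminals are constants $\Gamma_{T'}$ indexed by goal clauses $T'$, $\Gamma_{T_0}\in\mathcal{N}$, and whose rules have the form $\Gamma_{T'}\to\beta$ with $\beta$ a term over $\Sigma\cup\mathcal{N}$, non-terminals occurring only as first arguments of $\textsc{rec}$; in $\textsc{rec}(\Gamma_{t},\delta)$, $\delta$ is an idempotent renaming with $\mathcal{VR}an(\delta)\subseteq\mathcal{V}ar(t)$ and $\mathcal{D}om(\delta)\cap(\mathcal{V}ar(t)\setminus\mathcal{VR}an(\delta))=\emptyset$. $L(\mathcal{G},\Gamma)$ is the set of ground terms over $\Sigma$ derivable from $\Gamma$, and $\mathcal{S}ubst(\mathcal{G},\Gamma)=\{[\![e]\!]\mid e\in L(\mathcal{G},\Gamma),[\![e]\!]\neq\mathit{fail}\}$. Shape assumption: every rule reachable from $\Gamma_T$ is of the form $\Gamma_{T'}\to\theta$ or $\Gamma_{T'}\to\textsc{rec}(\Gamma_{T''},\delta)\bullet\theta$ (a rule $\Gamma_{T'}\to\textsc{rec}(\Gamma_{T''},\delta)$ counts as having $\theta=\mathit{id}$), where $\theta$ is idempotent with $\mathcal{D}om(\theta)=\mathcal{V}ar(T')$ and $\mathcal{VR}an(\delta)=\mathcal{V}ar(T'')$; and for each rule of the second kind, for all variables $x,y\in\mathcal{V}ar(T')$ and every $p\in\mathcal{P}os(\delta\theta(x))\cap\mathcal{P}os(\delta\theta(y))$: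 if $(\delta\theta(x))|_p\in\mathcal{V}ar(T'')$ then $(\delta\theta(y))|_p\in\mathcal{V}ar(T'')\cup\mathcal{T}(\mathcal{C},\mathcal{V}\setminus\mathcal{V}ar(T''))$, and symmetrically with $x,y$ swapped. Construction. $\mathrm{Pat}(\mathcal{P})=\{\{x\mapsto A\mid x\in\mathcal{V}ar(t)\}(t)\mid \theta$ appears in $\mathcal{P}$, $s\in\mathcal{R}an(\theta)$, $t$ a subterm of $s\}$; $\mathrm{Vars}(\mathcal{N})=\bigcup_{\Gamma_{T'}\in\mathcal{N}}\mathcal{V}ar(T')$. For a goal clause $T'$, the set $\langle s,t\rangle_{T'}$ is defined by: $\langle x,y\rangle_{T'}=\{\Gamma_{T'}^{(x,y)}\}$ for $x,y\in\mathcal{V}$; $\langle x,t\rangle_{T'}=\{\Gamma_{T'}^{(x,t)}\}$ and $\langle t,y\rangle_{T'}=\{\Gamma_{T'}^{(t,y)}\}$ for variables $x,y$ and $t\in\mathrm{Pat}(\mathcal{P})$; $\langle x,\bot\rangle_{T'}=\{\Gamma_{T'}^{(x,\bot)}\}$, $\langle\bot,y\rangle_{T'}=\{\Gamma_{T'}^{(\bot,y)}\}$; $\langle A,A\rangle_{T'}=\{[A,A]\}$, $\langle A,\bot\rangle_{T'}=\{[A,\bot]\}$, $\langle\bot,A\rangle_{T'}=\{[\bot,A]\}$ (three special non-terminals); $\langle\bot,g(t_1..t_n)\rangle_{T'}=\{\langle\bot,g\rangle(u_1..u_n)\mid u_i\in\langle\bot,t_i\rangle_{T'}\text{ for all }i\}$;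 $\langle f(s_1..s_m),\bot\rangle_{T'}=\{\langle f,\bot\rangle(u_1..u_m)\mid u_i\in\langle s_i,\bot\rangle_{T'}\}$; $\langle A,g(t_1..t_n)\rangle_{T'}$ is the set of all $\langle f,g\rangle(u_1,\dots)$ for $f/m\in\mathcal{C}$ where, if $m<n$, $u_i\in\langle A,t_i\rangle_{T'}$ ($i\le m$) and $u_{j}\in\langle\bot,t_{j}\rangle_{T'}$ ($m<j\le n$), and if $m\ge n$, $u_i\in\langle A,t_i\rangle_{T'}$ ($i\le n$) and $u_j\in\langle A,\bot\rangle_{T'}$ ($n<j\le m$); $\langle f(s_1..s_m),A\rangle_{T'}$ is the set of all $\langle f,g\rangle(u_1,\dots)$ for $g/n\in\mathcal{C}$ where, if $m<n$, $u_i\in\langle s_i,A\rangle_{T'}$ ($i\le m$) and $u_j\in\langle\bot,A\rangle_{T'}$ ($m<j\le n$), and if $m\ge n$, $u_i\in\langle s_i,A\rangle_{T'}$ ($i\le n$) and $u_j\in\langle s_j,\bot\rangle_{T'}$ ($n<j\le m$); $\langle f(s_1..s_m),g(t_1..t_n)\rangle_{T'}$ is the set of $\langle f,g\rangle(u_1,\dots)$ with $u_i\in\langle s_i,t_i\rangle_{T'}$ for $i\le\min(m,n)$ and the remaining arguments in $\langle\bot,t_j\rangle_{T'}$ (if $m<n$) or $\langle s_j,\bot\rangle_{T'}$ (if $m\ge n$). $\mathcal{R}an(\mathcal{G},T,x_1,x_2)$ is the regular tree grammar with initial non-terminal $\Gamma_T^{(x_1,x_2)}$, non-terminals $\Gamma_{T'}^{(x,y)},\Gamma_{T'}^{(x,t)},\Gamma_{T'}^{(t,y)}$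 ($x,y\in\mathrm{Vars}(\mathcal{N})$, $\Gamma_{T'}\in\mathcal{N}$, $t\in\mathrm{Pat}(\mathcal{P})\cup\{\bot\}$) and $[A,A],[A,\bot],[\bot,A]$, and rules: (i) $\Gamma_{T'}^{(t_1,t_2)}\to u$ for each rule $\Gamma_{T'}\to\theta$ of $\mathcal{P}$ and each $u\in\langle\xi_A\theta(t_1),\xi_A\theta(t_2)\rangle_{\top}$, where $\xi_A$ maps every variable of $\theta(t_1),\theta(t_2)$ to $A$; (ii) $\Gamma_{T'}^{(t_1,t_2)}\to u$ for each rule $\Gamma_{T'}\to\textsc{rec}(\Gamma_{T''},\delta)\bullet\theta$ of $\mathcal{P}$ and each $u\in\langle\xi_A\delta\theta(t_1),\xi_A\delta\theta(t_2)\rangle_{T''}$, where $\xi_A$ maps every variable of $\delta\theta(t_1),\delta\theta(t_2)$ not in $\mathcal{V}ar(T'')$ to $A$; (iii) $[A,A]\to u$ for all $f/m,g/n\in\mathcal{C}$ and $u\in\langle f(A,..,A),g(A,..,A)\rangle_{\top}$; $[A,\bot]\to u$ for $f\in\mathcal{C}$, $u\in\langle f(A,..,A),\bot\rangle_{\top}$; $[\bot,A]\to u$ for $g\in\mathcal{C}$, $u\in\langle\bot,g(A,..,A)\rangle_{\top}$. $\to_{\mathcal{G}'}$ denotes derivation with these rules. -}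

module Defs where

open import Data.Nat using (ℕ; zero; suc; _⊔_; _≡ᵇ_)
open import Data.Nat.Properties using (_≟_)
open import Data.Fin using (Fin)
open import Data.Bool using (Bool; true; false; if_then_else_)
open import Data.Empty using (⊥)
open import Data.Unit using (⊤)
open import Data.Maybe using (Maybe; just; nothing)
open import Data.Product using (Σ; ∃; _×_; _,_; proj₁; proj₂)
open import Data.Sum using (_⊎_)
open import Data.List using (List; []; _∷_; _++_; map; concatMap)
open import Data.List.Membership.Propositional using (_∈_)
open import Data.List.Membership.DecPropositional _≟_ using (_∈?_)
open import Data.Vec using (Vec; []; _∷_; replicate; lookup; _[_]≔_)
import Data.Vec.Membership.Propositional as VecM
open import Relation.Nullary using (¬_; does)
open import Relation.Binary.PropositionalEquality using (_≡_)
open import Relation.Binary.Construct.Closure.ReflexiveTransitive using (Star)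

record Sig : Set where
  field
    nC : ℕ
    ar : Fin nC → ℕ

_⊆_ : List ℕ → List ℕ → Set
xs ⊆ ys = ∀ {x} → x ∈ xs → x ∈ ys

_≐_ : List ℕ → List ℕ → Set
xs ≐ ys = (xs ⊆ ys) × (ys ⊆ xs)

module WithSig (S : Sig) where
  open Sig S

  -- Term  = T(C,V)      (variables are natural numbers)
  --   GTerm = T(C)        (ground terms)
  --   ATerm = terms over C ∪ {A} ∪ V  (leaf nothing = the fresh constant A)
  data Tm (L : Set) : Set where
    leaf : L → Tm L
    con  : (f : Fin nC) → Vec (Tm L) (ar f) → Tm L

  Term : Set
  Term = Tm ℕ

  GTerm : Set
  GTerm = Tm ⊥

  ATerm : Set
  ATerm = Tm (Maybe ℕ)

  var : ℕ → Term
  var = leaf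

  A : ATerm
  A = leaf nothing

  avar : ℕ → ATerm
  avar x = leaf (just x)

  mutual
    bind : {L L' : Set} → (L → Tm L') → Tm L → Tm L'
    bind σ (leaf x)   = σ x
    bind σ (con f ts) = con f (bindV σ ts)

    bindV : {L L' : Set} {n : ℕ} → (L → Tm L') → Vec (Tm L) n → Vec (Tm L') n
    bindV σ []       = []
    bindV σ (t ∷ ts) = bind σ t ∷ bindV σ ts

  mutual
    Var : Term → List ℕ
    Var (leaf x)   = x ∷ []
    Var (con f ts) = VarV ts

    VarV : {n : ℕ} → Vec Term n → List ℕ
    VarV []       = []
    VarV (t ∷ ts) = Var t ++ VarV ts

  embG : GTerm → Term
  embG = bind (λ ())

  embA : Term → ATerm
  embA = bind (λ x → leaf (just x))

  data _⊴_ : Term → Term → Set where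
    here  : ∀ {t} → t ⊴ t
    below : ∀ {s t f} {ts : Vec Term (ar f)} → s ⊴ t → t VecM.∈ ts → s ⊴ con f ts

  mutual
    _at_ : Term → List ℕ → Maybe Term
    t at []               = just t
    leaf x at (i ∷ p)     = nothing
    con f ts at (i ∷ p)   = atV ts i p

    atV : {n : ℕ} → Vec Term n → ℕ → List ℕ → Maybe Term
    atV []       i       p = nothing
    atV (t ∷ ts) zero    p = t at p
    atV (t ∷ ts) (suc i) p = atV ts i p

  Subst : Set
  Subst = List (ℕ × Term)

  lookupS : Subst → ℕ → Term
  lookupS []            x = var x
  lookupS ((y , t) ∷ σ) x = if x ≡ᵇ y then t else lookupS σ x

  applyT : Subst → Term → Term
  applyT σ = bind (lookupS σ)

  applyA : Subst → ATerm → ATerm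
  applyA σ = bind λ { nothing → A ; (just x) → embA (lookupS σ x) }

  Dom : Subst → List ℕ
  Dom = map proj₁

  _∈Ran_ : Term → Subst → Set
  t ∈Ran σ = ∃ λ x → (x , t) ∈ σ

  VRan : Subst → List ℕ
  VRan σ = concatMap (λ p → Var (proj₂ p)) σ

  Idempotent : Subst → Set
  Idempotent θ = ∀ {x} → x ∈ Dom θ → applyT θ (lookupS θ x) ≡ lookupS θ x

  Renaming : Subst → Set
  Renaming δ = (∀ {x t} → (x , t) ∈ δ → ∃ λ y → t ≡ var y)
             × (∀ {x y} → x ∈ Dom δ → y ∈ Dom δ → lookupS δ x ≡ lookupS δ y → x ≡ y)

  IdemRenaming : Subst → Set
  IdemRenaming δ = Idempotent δ × Renaming δ

  GroundRange : Subst → Set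
  GroundRange σ = ∀ {x t} → (x , t) ∈ σ → Var t ≡ []

  -- Goal clauses: conjunctions of pairs of terms; ⊤ is the empty one.

  GC : Set
  GC = List (Term × Term)

  VarGC : GC → List ℕ
  VarGC = concatMap (λ p → Var (proj₁ p) ++ Var (proj₂ p))

  ⊤GC : GC
  ⊤GC = []

  -- Substitution expressions over Σ ∪ N (non-terminals Γ_T' are
  -- identified with their goal clause T'; non-terminals may occur only
  -- as first argument of rec).

  mutual
    data Expr : Set where
      sub  : Subst → Expr
      ∅    : Expr
      _•_  : Expr → Expr → Expr
      _&_  : Expr → Expr → Expr
      rec  : RArg → Subst → Expr

    data RArg : Set where
      ntA : GC → RArg
      exA : Expr → RArg

  mutual
    data SubIn (θ : Subst) : Expr → Set where
      s-here : SubIn θ (sub θ)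
      s-•l   : ∀ {a b} → SubIn θ a → SubIn θ (a • b)
      s-•r   : ∀ {a b} → SubIn θ b → SubIn θ (a • b)
      s-&l   : ∀ {a b} → SubIn θ a → SubIn θ (a & b)
      s-&r   : ∀ {a b} → SubIn θ b → SubIn θ (a & b)
      s-rec  : ∀ {e δ} → SubIn θ e → SubIn θ (rec (exA e) δ)

  data NTIn (T'' : GC) : Expr → Set where
    n-here : ∀ {δ} → NTIn T'' (rec (ntA T'') δ)
    n-•l   : ∀ {a b} → NTIn T'' a → NTIn T'' (a • b)
    n-•r   : ∀ {a b} → NTIn T'' b → NTIn T'' (a • b)
    n-&l   : ∀ {a b} → NTIn T'' a → NTIn T'' (a & b)
    n-&r   : ∀ {a b} → NTIn T'' b → NTIn T'' (a & b)
    n-rec  : ∀ {e δ} → NTIn T'' e → NTIn T'' (rec (exA e) δ)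

  data RecIn (r : RArg) (δ : Subst) : Expr → Set where
    r-here : RecIn r δ (rec r δ)
    r-•l   : ∀ {a b} → RecIn r δ a → RecIn r δ (a • b)
    r-•r   : ∀ {a b} → RecIn r δ b → RecIn r δ (a • b)
    r-&l   : ∀ {a b} → RecIn r δ a → RecIn r δ (a & b)
    r-&r   : ∀ {a b} → RecIn r δ b → RecIn r δ (a & b)
    r-rec  : ∀ {e δ'} → RecIn r δ e → RecIn r δ (rec (exA e) δ')

  record SSG : Set where
    field
      T0 : GC
      N  : List GC
      P  : List (GC × Expr)
      T0∈N   : T0 ∈ N
      lhs∈N  : ∀ {T' β} → (T' , β) ∈ P → T' ∈ N
      nt∈N   : ∀ {T' β T''} → (T' , β) ∈ P → NTIn T'' β → T'' ∈ N
      subIdem : ∀ {T' β θ} → (T' , β) ∈ P → SubIn θ β → Idempotent θ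
      recRen  : ∀ {T' β r δ} → (T' , β) ∈ P → RecIn r δ β → IdemRenaming δ
      recNT   : ∀ {T' β T'' δ} → (T' , β) ∈ P → RecIn (ntA T'') δ β →
                  (VRan δ ⊆ VarGC T'')
                × (∀ {x} → x ∈ Dom δ → x ∈ VarGC T'' → x ∈ VRan δ)
  open SSG public

  data Reach (G : SSG) (T : GC) : GC → Set where
    r-refl : Reach G T T
    r-step : ∀ {T₁ β T₂} → Reach G T T₁ → (T₁ , β) ∈ P G → NTIn T₂ β → Reach G T T₂

  Avoids : List ℕ → Term → Set
  Avoids X t = ∀ {x} → x ∈ Var t → ¬ (x ∈ X)

  PosCond : GC → GC → Subst → Subst → Set
  PosCond T' T'' δ θ =
    ∀ {x y} → x ∈ VarGC T' → y ∈ VarGC T' →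
    ∀ (p : List ℕ) {s t} →
      (applyT δ (lookupS θ x)) at p ≡ just s →
      (applyT δ (lookupS θ y)) at p ≡ just t →
        ((∃ λ z → s ≡ var z × z ∈ VarGC T'') →
           (∃ λ z → t ≡ var z × z ∈ VarGC T'') ⊎ Avoids (VarGC T'') t)
      × ((∃ λ z → t ≡ var z × z ∈ VarGC T'') →
           (∃ λ z → s ≡ var z × z ∈ VarGC T'') ⊎ Avoids (VarGC T'') s)

  idOn : List ℕ → Subst
  idOn = map (λ x → x , var x)

  data Shape (T' : GC) : Expr → Set where
    sh-sub : ∀ {θ} → Dom θ ≐ VarGC T' → Shape T' (sub θ)
    sh-rec : ∀ {T'' δ θ} → Dom θ ≐ VarGC T' → VRan δ ≐ VarGC T'' →
             PosCond T' T'' δ θ → Shape T' (rec (ntA T'') δ • sub θ)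
    -- Γ_T' → rec(Γ_T'', δ) counts as θ = id (on Var(T'))
    sh-rec-id : ∀ {T'' δ} → VRan δ ≐ VarGC T'' →
             PosCond T' T'' δ (idOn (VarGC T')) → Shape T' (rec (ntA T'') δ)

  ShapeAssumption : SSG → GC → Set
  ShapeAssumption G T = ∀ {T' β} → Reach G T T' → (T' , β) ∈ P G → Shape T' β

  Pat : SSG → ATerm → Set
  Pat G a = ∃ λ T' → ∃ λ β → ∃ λ θ → ∃ λ s → ∃ λ t →
              ((T' , β) ∈ P G) × SubIn θ β × (s ∈Ran θ) × (t ⊴ s)
              × (a ≡ bind (λ _ → A) t)

  VarsN : SSG → ℕ → Set
  VarsN G x = ∃ λ T' → T' ∈ N G × x ∈ VarGC T'

  -- Pair signature (C ∪ {⊥})² and trees over it with non-terminals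

  data PSym : Set where
    both : Fin nC → Fin nC → PSym
    lft  : Fin nC → PSym
    rgt  : Fin nC → PSym

  parity : PSym → ℕ
  parity (both f g) = ar f ⊔ ar g
  parity (lft f)    = ar f
  parity (rgt g)    = ar g

  -- a component of a pair: an (A-)term or ⊥
  data Side : Set where
    tm  : ATerm → Side
    bot : Side

  substS : Subst → Side → Side
  substS σ (tm a) = tm (applyA σ a)
  substS σ bot    = bot

  xiA : List ℕ → ATerm → ATerm
  xiA X = bind λ { nothing → A ; (just x) → if does (x ∈? X) then avar x else A }

  xiS : List ℕ → Side → Side
  xiS X (tm a) = tm (xiA X a)
  xiS X bot    = bot

  data NT : Set where
    Γ    : GC → Side → Side → NT
    [A,A] [A,⊥] [⊥,A] : NT

  data PTree : Set where
    nt   : NT → PTree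
    node : (p : PSym) → Vec PTree (parity p) → PTree

  mutual
    code2 : GTerm → GTerm → PTree
    code2 (con f ss) (con g ts) = node (both f g) (code2V ss ts)

    code2V : {m n : ℕ} → Vec GTerm m → Vec GTerm n → Vec PTree (m ⊔ n)
    code2V []       []       = []
    code2V []       (t ∷ ts) = codeR t ∷ codeRV ts
    code2V (s ∷ ss) []       = codeL s ∷ codeLV ss
    code2V (s ∷ ss) (t ∷ ts) = code2 s t ∷ code2V ss ts

    codeL : GTerm → PTree
    codeL (con f ss) = node (lft f) (codeLV ss)

    codeLV : {m : ℕ} → Vec GTerm m → Vec PTree m
    codeLV []       = []
    codeLV (s ∷ ss) = codeL s ∷ codeLV ss

    codeR : GTerm → PTree
    codeR (con g ts) = node (rgt g) (codeRV ts)

    codeRV : {n : ℕ} → Vec GTerm n → Vec PTree n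
    codeRV []       = []
    codeRV (t ∷ ts) = codeR t ∷ codeRV ts

  -- the sets ⟨s,t⟩_T' (membership predicate Mem G T' s t u)

  mutual
    data Mem (G : SSG) (T' : GC) : Side → Side → PTree → Set where
      m-vv : ∀ x y → Mem G T' (tm (avar x)) (tm (avar y)) (nt (Γ T' (tm (avar x)) (tm (avar y))))
      m-vt : ∀ x t → Pat G t → Mem G T' (tm (avar x)) (tm t) (nt (Γ T' (tm (avar x)) (tm t)))
      m-tv : ∀ t y → Pat G t → Mem G T' (tm t) (tm (avar y)) (nt (Γ T' (tm t) (tm (avar y))))
      m-v⊥ : ∀ x → Mem G T' (tm (avar x)) bot (nt (Γ T' (tm (avar x)) bot))
      m-⊥v : ∀ y → Mem G T' bot (tm (avar y)) (nt (Γ T' bot (tm (avar y))))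
      m-AA : Mem G T' (tm A) (tm A) (nt [A,A])
      m-A⊥ : Mem G T' (tm A) bot (nt [A,⊥])
      m-⊥A : Mem G T' bot (tm A) (nt [⊥,A])
      m-⊥g : ∀ g {ts us} → MemR G T' ts us → Mem G T' bot (tm (con g ts)) (node (rgt g) us)
      m-f⊥ : ∀ f {ss us} → MemL G T' ss us → Mem G T' (tm (con f ss)) bot (node (lft f) us)
      m-Ag : ∀ f g {ts us} → MemArgs G T' (replicate (ar f) A) ts us →
               Mem G T' (tm A) (tm (con g ts)) (node (both f g) us)
      m-fA : ∀ f g {ss us} → MemArgs G T' ss (replicate (ar g) A) us →
               Mem G T' (tm (con f ss)) (tm A) (node (both f g) us)
      m-fg : ∀ f g {ss ts us} → MemArgs G T' ss ts us →
               Mem G T' (tm (con f ss)) (tm (con g ts)) (node (both f g) us)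

    data MemArgs (G : SSG) (T' : GC) : {m n : ℕ} → Vec ATerm m → Vec ATerm n →
                                        Vec PTree (m ⊔ n) → Set where
      a-nil : MemArgs G T' [] [] []
      a-l   : ∀ {m s u} {ss : Vec ATerm m} {us} → Mem G T' (tm s) bot u → MemL G T' ss us →
                MemArgs G T' (s ∷ ss) [] (u ∷ us)
      a-r   : ∀ {n t u} {ts : Vec ATerm n} {us} → Mem G T' bot (tm t) u → MemR G T' ts us →
                MemArgs G T' [] (t ∷ ts) (u ∷ us)
      a-c   : ∀ {m n s t u} {ss : Vec ATerm m} {ts : Vec ATerm n} {us} →
                Mem G T' (tm s) (tm t) u → MemArgs G T' ss ts us →
                MemArgs G T' (s ∷ ss) (t ∷ ts) (u ∷ us)

    data MemL (G : SSG) (T' : GC) : {m : ℕ} → Vec ATerm m → Vec PTree m → Set where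
      l-nil  : MemL G T' [] []
      l-cons : ∀ {m s u} {ss : Vec ATerm m} {us} → Mem G T' (tm s) bot u → MemL G T' ss us →
                 MemL G T' (s ∷ ss) (u ∷ us)

    data MemR (G : SSG) (T' : GC) : {n : ℕ} → Vec ATerm n → Vec PTree n → Set where
      r-nil  : MemR G T' [] []
      r-cons : ∀ {n t u} {ts : Vec ATerm n} {us} → Mem G T' bot (tm t) u → MemR G T' ts us →
                 MemR G T' (t ∷ ts) (u ∷ us)

  data PatOrBot (G : SSG) : Side → Set where
    pb-pat : ∀ {t} → Pat G t → PatOrBot G (tm t)
    pb-bot : PatOrBot G bot

  data ValidNT (G : SSG) : NT → Set where
    v-vv : ∀ {T' x y} → T' ∈ N G → VarsN G x → VarsN G y →
             ValidNT G (Γ T' (tm (avar x)) (tm (avar y)))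
    v-vt : ∀ {T' x b} → T' ∈ N G → VarsN G x → PatOrBot G b →
             ValidNT G (Γ T' (tm (avar x)) b)
    v-tv : ∀ {T' a y} → T' ∈ N G → PatOrBot G a → VarsN G y →
             ValidNT G (Γ T' a (tm (avar y)))

  allA : Fin nC → ATerm
  allA f = con f (replicate (ar f) A)

  data RanRule (G : SSG) : NT → PTree → Set where
    rule-i   : ∀ {T' a b θ u} → ValidNT G (Γ T' a b) → (T' , sub θ) ∈ P G →
                 Mem G ⊤GC (xiS [] (substS θ a)) (xiS [] (substS θ b)) u →
                 RanRule G (Γ T' a b) u
    rule-ii  : ∀ {T' a b T'' δ θ u} → ValidNT G (Γ T' a b) →
                 (T' , (rec (ntA T'') δ • sub θ)) ∈ P G →
                 Mem G T'' (xiS (VarGC T'') (substS δ (substS θ a)))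
                           (xiS (VarGC T'') (substS δ (substS θ b))) u →
                 RanRule G (Γ T' a b) u
    rule-ii' : ∀ {T' a b T'' δ u} → ValidNT G (Γ T' a b) →
                 (T' , rec (ntA T'') δ) ∈ P G →
                 Mem G T'' (xiS (VarGC T'') (substS δ a))
                           (xiS (VarGC T'') (substS δ b)) u →
                 RanRule G (Γ T' a b) u
    rule-AA  : ∀ f g {u} → Mem G ⊤GC (tm (allA f)) (tm (allA g)) u → RanRule G [A,A] u
    rule-A⊥  : ∀ f {u} → Mem G ⊤GC (tm (allA f)) bot u → RanRule G [A,⊥] u
    rule-⊥A  : ∀ g {u} → Mem G ⊤GC bot (tm (allA g)) u → RanRule G [⊥,A] u

  record RTG : Set₁ where
    field
      start : NT
      rule  : NT → PTree → Set

  Ran : SSG → GC → ℕ → ℕ → RTG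
  Ran G T x₁ x₂ = record { start = Γ T (tm (avar x₁)) (tm (avar x₂)) ; rule = RanRule G }

  data Step (R : RTG) : PTree → PTree → Set where
    step-here  : ∀ {X u} → RTG.rule R X u → Step R (nt X) u
    step-under : ∀ {p us v} (i : Fin (parity p)) → Step R (lookup us i) v →
                   Step R (node p us) (node p (us [ i ]≔ v))

  Derives : RTG → PTree → PTree → Set
  Derives R u v = Star (Step R) u v

-- Erasing the variables of t to A yields a pattern that ξ(t) instantiates, A being a wildcard.
-- Following that pattern, a member of ⟨ξ_A(t₁), ξ_A(t₂)⟩_⊤ is built leaf by leaf; wherever the
-- pattern has an A, the member has one of [A,A], [A,⊥], [⊥,A], and a rule (iii) followed by the
-- same construction for the all-A pattern f(A,…,A) regenerates the ground subterm that A stands for.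
-- Only the rules (iii) are used, so the hypotheses on T, x₁, x₂ and the shape assumption are idle.
module Submission where

open import Defs
open import Data.Nat using (ℕ)
open import Data.Fin using (Fin; zero; suc)
open import Data.Product using (Σ; ∃; _×_; _,_)
open import Data.List using ([]; _++_)
open import Data.List.Membership.Propositional using (_∈_)
open import Data.Maybe using (Maybe; just)
open import Data.Vec using (Vec; []; _∷_; replicate; lookup; _[_]≔_)
open import Data.Vec.Properties using (∷-injective)
open import Data.Vec.Relation.Binary.Pointwise.Inductive using (Pointwise; []; _∷_)
open import Function using (_∘_)
open import Relation.Binary.PropositionalEquality using (_≡_; refl)
open import Relation.Binary.Construct.Closure.ReflexiveTransitive using (ε; _◅_; _◅◅_; gmap)

module Instances (S : Sig) where
  open Sig S
  open WithSig S

  infix 4 _≼_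

  data _≼_ : ATerm → GTerm → Set where
    A≼   : ∀ {g} → A ≼ g
    con≼ : ∀ {f as gs} → Pointwise _≼_ as gs → con f as ≼ con f gs

  replicateA-≼ : ∀ {n} (gs : Vec GTerm n) → Pointwise _≼_ (replicate n A) gs
  replicateA-≼ []       = []
  replicateA-≼ (g ∷ gs) = A≼ ∷ replicateA-≼ gs

  con-injective : ∀ {L : Set} {f f' : Fin nC} {ts : Vec (Tm L) (ar f)} {ts' : Vec (Tm L) (ar f')} →
                  con f ts ≡ con f' ts' → Σ (f ≡ f') λ { refl → ts ≡ ts' }
  con-injective refl = refl , refl

  -- xiA [] is bind h for such an h; h stays abstract because its pattern lambda cannot be named.
  module _ (ξ : Subst) (h : Maybe ℕ → ATerm) (h-vars : ∀ x → h (just x) ≡ A) where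

    eraseVars-≼ : ∀ t g → embG g ≡ applyT ξ t → bind h (embA t) ≼ g
    eraseVarsV-≼ : ∀ {n} (ts : Vec Term n) gs → bindV (λ ()) gs ≡ bindV (lookupS ξ) ts →
                   Pointwise _≼_ (bindV h (bindV (leaf ∘ just) ts)) gs

    eraseVars-≼ (leaf x) g _ rewrite h-vars x = A≼
    eraseVars-≼ (con f ts) (con f' gs) eq with con-injective eq
    ... | refl , eqs = con≼ (eraseVarsV-≼ ts gs eqs)

    eraseVarsV-≼ []       []       _  = []
    eraseVarsV-≼ (t ∷ ts) (g ∷ gs) eq with ∷-injective eq
    ... | eq₁ , eqs = eraseVars-≼ t g eq₁ ∷ eraseVarsV-≼ ts gs eqs

module Derivations (S : Sig) (R : WithSig.RTG S) where
  open WithSig S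

  -- The context generalises node p so that the induction can freeze the already rewritten prefix.
  derives-under : ∀ {n} (ctx : Vec PTree n → PTree) →
                  (∀ i {ws v} → Step R (lookup ws i) v → Step R (ctx ws) (ctx (ws [ i ]≔ v))) →
                  ∀ {us vs} → Pointwise (Derives R) us vs → Derives R (ctx us) (ctx vs)
  derives-under ctx step-ctx [] = ε
  derives-under ctx step-ctx {u ∷ us} {v ∷ vs} (d ∷ ds) =
    gmap (λ w → ctx (w ∷ us)) (λ {w} s → step-ctx zero {w ∷ us} s) d
    ◅◅ derives-under (λ ws → ctx (v ∷ ws)) (λ i {ws} s → step-ctx (suc i) {v ∷ ws} s) ds

  derives-node : ∀ p {us vs} → Pointwise (Derives R) us vs → Derives R (node p us) (node p vs)
  derives-node p = derives-under (node p) (λ i s → step-under i s)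

module Members (S : Sig) (G : WithSig.SSG S) (T : WithSig.GC S) (x₁ x₂ : ℕ) where
  open WithSig S
  open Instances S using (_≼_; A≼; con≼; replicateA-≼)
  open Derivations S (Ran G T x₁ x₂) using (derives-node)

  infix 4 _⇒*_
  _⇒*_ : PTree → PTree → Set
  _⇒*_ = Derives (Ran G T x₁ x₂)

  pair-member : ∀ {a b g₁ g₂} → a ≼ g₁ → b ≼ g₂ →
                ∃ λ u → Mem G ⊤GC (tm a) (tm b) u × u ⇒* code2 g₁ g₂
  left-member : ∀ {a g} → a ≼ g → ∃ λ u → Mem G ⊤GC (tm a) bot u × u ⇒* codeL g
  right-member : ∀ {b g} → b ≼ g → ∃ λ u → Mem G ⊤GC bot (tm b) u × u ⇒* codeR g
  pair-members : ∀ {m n} {as : Vec ATerm m} {bs : Vec ATerm n}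
                 {gs₁ : Vec GTerm m} {gs₂ : Vec GTerm n} →
                 Pointwise _≼_ as gs₁ → Pointwise _≼_ bs gs₂ →
                 ∃ λ us → MemArgs G ⊤GC as bs us × Pointwise _⇒*_ us (code2V gs₁ gs₂)
  left-members : ∀ {m} {as : Vec ATerm m} {gs : Vec GTerm m} → Pointwise _≼_ as gs →
                 ∃ λ us → MemL G ⊤GC as us × Pointwise _⇒*_ us (codeLV gs)
  right-members : ∀ {n} {bs : Vec ATerm n} {gs : Vec GTerm n} → Pointwise _≼_ bs gs →
                  ∃ λ us → MemR G ⊤GC bs us × Pointwise _⇒*_ us (codeRV gs)

  pair-member {g₁ = con f gs₁} {con g gs₂} A≼ A≼ =
    let us , mem , ds = pair-members (replicateA-≼ gs₁) (replicateA-≼ gs₂) in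
    nt [A,A] , m-AA , step-here (rule-AA f g (m-fg f g mem)) ◅ derives-node (both f g) ds
  pair-member {g₁ = con f gs₁} {con g _} A≼ (con≼ ps₂) =
    let us , mem , ds = pair-members (replicateA-≼ gs₁) ps₂ in
    node (both f g) us , m-Ag f g mem , derives-node (both f g) ds
  pair-member {g₁ = con f _} {con g gs₂} (con≼ ps₁) A≼ =
    let us , mem , ds = pair-members ps₁ (replicateA-≼ gs₂) in
    node (both f g) us , m-fA f g mem , derives-node (both f g) ds
  pair-member {g₁ = con f _} {con g _} (con≼ ps₁) (con≼ ps₂) =
    let us , mem , ds = pair-members ps₁ ps₂ in
    node (both f g) us , m-fg f g mem , derives-node (both f g) ds

  left-member {g = con f gs} A≼ =
    let us , mem , ds = left-members (replicateA-≼ gs) in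
    nt [A,⊥] , m-A⊥ , step-here (rule-A⊥ f (m-f⊥ f mem)) ◅ derives-node (lft f) ds
  left-member {g = con f _} (con≼ ps) =
    let us , mem , ds = left-members ps in
    node (lft f) us , m-f⊥ f mem , derives-node (lft f) ds

  right-member {g = con g gs} A≼ =
    let us , mem , ds = right-members (replicateA-≼ gs) in
    nt [⊥,A] , m-⊥A , step-here (rule-⊥A g (m-⊥g g mem)) ◅ derives-node (rgt g) ds
  right-member {g = con g _} (con≼ ps) =
    let us , mem , ds = right-members ps in
    node (rgt g) us , m-⊥g g mem , derives-node (rgt g) ds

  pair-members [] [] = [] , a-nil , []
  pair-members [] (p ∷ ps) =
    let u , mem , d = right-member p
        us , mems , ds = right-members ps in
    u ∷ us , a-r mem mems , d ∷ ds
  pair-members (p ∷ ps) [] =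
    let u , mem , d = left-member p
        us , mems , ds = left-members ps in
    u ∷ us , a-l mem mems , d ∷ ds
  pair-members (p ∷ ps) (q ∷ qs) =
    let u , mem , d = pair-member p q
        us , mems , ds = pair-members ps qs in
    u ∷ us , a-c mem mems , d ∷ ds

  left-members [] = [] , l-nil , []
  left-members (p ∷ ps) =
    let u , mem , d = left-member p
        us , mems , ds = left-members ps in
    u ∷ us , l-cons mem mems , d ∷ ds

  right-members [] = [] , r-nil , []
  right-members (p ∷ ps) =
    let u , mem , d = right-member p
        us , mems , ds = right-members ps in
    u ∷ us , r-cons mem mems , d ∷ ds

open WithSig

lemma16 : (S : Sig) (G : SSG S) (T : GC S) (x₁ x₂ : ℕ) →
    T ∈ N G → x₁ ∈ VarGC S T → x₂ ∈ VarGC S T →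
    ShapeAssumption S G T →
    (t₁ t₂ : Term S) (ξ : Subst S) → GroundRange S ξ →
    (Var S t₁ ++ Var S t₂) ⊆ Dom S ξ →
    (g₁ g₂ : GTerm S) → embG S g₁ ≡ applyT S ξ t₁ → embG S g₂ ≡ applyT S ξ t₂ →
      (∃ λ u → Mem S G (⊤GC S) (tm (xiA S [] (embA S t₁))) (tm (xiA S [] (embA S t₂))) u
               × Derives S (Ran S G T x₁ x₂) u (code2 S g₁ g₂))
    × (∃ λ u → Mem S G (⊤GC S) (tm (xiA S [] (embA S t₁))) bot u
               × Derives S (Ran S G T x₁ x₂) u (codeL S g₁))
    × (∃ λ u → Mem S G (⊤GC S) bot (tm (xiA S [] (embA S t₂))) u
               × Derives S (Ran S G T x₁ x₂) u (codeR S g₂))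
lemma16 S G T x₁ x₂ _ _ _ _ t₁ t₂ ξ _ _ g₁ g₂ eq₁ eq₂ =
  pair-member p₁ p₂ , left-member p₁ , right-member p₂
  where
    open Instances S using (eraseVars-≼)
    open Members S G T x₁ x₂
    p₁ = eraseVars-≼ ξ _ (λ _ → refl) t₁ g₁ eq₁
    p₂ = eraseVars-≼ ξ _ (λ _ → refl) t₂ g₂ eq₂
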